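{- For every $\phi\in\mathcal{L}_m$, $\phi\in\mathsf{IK}$ iff $Tr(\phi)\in\mathsf{IntCK}$.
   Context: $\mathcal{L}_m$ is the modal language given by $\phi::=p\mid\top\mid\bot\mid\phi\wedge\phi\mid\phi\vee\phi\mid\phi\to\phi\mid\Box\phi\mid\Diamond\phi$ ($p$ a propositional variable); $\neg\phi:=\phi\to\bot$. $\mathcal{L}$ is built from the same variables and $\top,\bot$ by $\wedge,\vee,\to$ and connectives $\phi\mathbin{\Box\!\!\to}\psi$, $\phi\mathbin{\Diamond\!\!\to}\psi$. $Tr:\mathcal{L}_m\to\mathcal{L}$ fixes variables and $\top,\bot$, commutes with $\wedge,\vee,\to$, and sets $Tr(\Box\psi)=\top\mathbin{\Box\!\!\to}Tr(\psi)$, $Tr(\Diamond\psi)=\top\mathbin{\Diamond\!\!\to}Tr(\psi)$. $\mathsf{IK}$ is the set of $\mathcal{L}_m$-formulas provable from all instances of a complete axiomatization of intuitionistic propositional logic and (a1) $\Box(\phi\to\psi)\to(\Box\phi\to\Box\psi)$, (a2) $\Box(\phi\to\psi)\to(\Diamond\phi\to\Diamond\psi)$, (a3) $\neg\Diamond\bot$, (a4) $\Diamond(\phi\vee\psi)\to(\Diamond\phi\vee\Diamond\psi)$, (a5) $(\Diamond\phi\to\Box\psi)\to\Box(\phi\to\psi)$, by modus ponens and necessitation (from $\phi$ infer $\Box\phi$). $\mathsf{IntCK}$ is the set of $\mathcal{L}$-formulas provable from: (A0) all $\mathcal{L}$-instances of a complete axiomatization of intuitionistic propositional logic; (A1) $((\phi\mathbin{\Box\!\!\to}\psi)\wedge(\phi\mathbin{\Box\!\!\to}\chi))\leftrightarrow(\phi\mathbin{\Box\!\!\to}(\psi\wedge\chi))$;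 (A2) $((\phi\mathbin{\Diamond\!\!\to}\psi)\wedge(\phi\mathbin{\Box\!\!\to}\chi))\to(\phi\mathbin{\Diamond\!\!\to}(\psi\wedge\chi))$; (A3) $(\phi\mathbin{\Diamond\!\!\to}(\psi\vee\chi))\leftrightarrow((\phi\mathbin{\Diamond\!\!\to}\psi)\vee(\phi\mathbin{\Diamond\!\!\to}\chi))$; (A4) $((\phi\mathbin{\Diamond\!\!\to}\psi)\to(\phi\mathbin{\Box\!\!\to}\chi))\to(\phi\mathbin{\Box\!\!\to}(\psi\to\chi))$; (A5) $\phi\mathbin{\Box\!\!\to}\top$; (A6) $\neg(\phi\mathbin{\Diamond\!\!\to}\bot)$; by modus ponens and the rules: from $\phi\leftrightarrow\psi$ infer $(\phi\mathbin{\Box\!\!\to}\chi)\leftrightarrow(\psi\mathbin{\Box\!\!\to}\chi)$, $(\chi\mathbin{\Box\!\!\to}\phi)\leftrightarrow(\chi\mathbin{\Box\!\!\to}\psi)$, and the same two with $\mathbin{\Diamond\!\!\to}$ (equivalently, the formulas valid in all Chellas models). -}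

module Defs where

open import Data.Nat using (ℕ)

Var : Set
Var = ℕ

infixr 6 _∧ₘ_
infixr 5 _∨ₘ_
infixr 4 _⇒ₘ_

data Fmₘ : Set where
  var  : Var → Fmₘ
  ⊤ₘ   : Fmₘ
  ⊥ₘ   : Fmₘ
  _∧ₘ_ : Fmₘ → Fmₘ → Fmₘ
  _∨ₘ_ : Fmₘ → Fmₘ → Fmₘ
  _⇒ₘ_ : Fmₘ → Fmₘ → Fmₘ
  □_   : Fmₘ → Fmₘ
  ◇_   : Fmₘ → Fmₘ

¬ₘ_ : Fmₘ → Fmₘ
¬ₘ φ = φ ⇒ₘ ⊥ₘ

infixr 6 _∧_
infixr 5 _∨_
infixr 4 _⇒_
infixr 7 _□→_ _◇→_

data Fm : Set where
  var  : Var → Fm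
  ⊤'   : Fm
  ⊥'   : Fm
  _∧_  : Fm → Fm → Fm
  _∨_  : Fm → Fm → Fm
  _⇒_  : Fm → Fm → Fm
  _□→_ : Fm → Fm → Fm
  _◇→_ : Fm → Fm → Fm

¬'_ : Fm → Fm
¬' φ = φ ⇒ ⊥'

_⇔_ : Fm → Fm → Fm
φ ⇔ ψ = (φ ⇒ ψ) ∧ (ψ ⇒ φ)

Tr : Fmₘ → Fm
Tr (var p)  = var p
Tr ⊤ₘ       = ⊤'
Tr ⊥ₘ       = ⊥'
Tr (φ ∧ₘ ψ) = Tr φ ∧ Tr ψ
Tr (φ ∨ₘ ψ) = Tr φ ∨ Tr ψ
Tr (φ ⇒ₘ ψ) = Tr φ ⇒ Tr ψ
Tr (□ φ)    = ⊤' □→ Tr φ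
Tr (◇ φ)    = ⊤' ◇→ Tr φ

-- The logic IK (Hilbert system).  The intuitionistic propositional base is
-- the standard complete Hilbert axiomatization (K, S, ∧/∨ intro/elim,
-- ex falso, ⊤).

data IK⊢ : Fmₘ → Set where
  ax-K   : ∀ φ ψ → IK⊢ (φ ⇒ₘ (ψ ⇒ₘ φ))
  ax-S   : ∀ φ ψ χ → IK⊢ ((φ ⇒ₘ (ψ ⇒ₘ χ)) ⇒ₘ ((φ ⇒ₘ ψ) ⇒ₘ (φ ⇒ₘ χ)))
  ax-∧I  : ∀ φ ψ → IK⊢ (φ ⇒ₘ (ψ ⇒ₘ (φ ∧ₘ ψ)))
  ax-∧E₁ : ∀ φ ψ → IK⊢ ((φ ∧ₘ ψ) ⇒ₘ φ)
  ax-∧E₂ : ∀ φ ψ → IK⊢ ((φ ∧ₘ ψ) ⇒ₘ ψ)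
  ax-∨I₁ : ∀ φ ψ → IK⊢ (φ ⇒ₘ (φ ∨ₘ ψ))
  ax-∨I₂ : ∀ φ ψ → IK⊢ (ψ ⇒ₘ (φ ∨ₘ ψ))
  ax-∨E  : ∀ φ ψ χ → IK⊢ ((φ ⇒ₘ χ) ⇒ₘ ((ψ ⇒ₘ χ) ⇒ₘ ((φ ∨ₘ ψ) ⇒ₘ χ)))
  ax-⊥E  : ∀ φ → IK⊢ (⊥ₘ ⇒ₘ φ)
  ax-⊤   : IK⊢ ⊤ₘ
  a1 : ∀ φ ψ → IK⊢ (□ (φ ⇒ₘ ψ) ⇒ₘ (□ φ ⇒ₘ □ ψ))
  a2 : ∀ φ ψ → IK⊢ (□ (φ ⇒ₘ ψ) ⇒ₘ (◇ φ ⇒ₘ ◇ ψ))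
  a3 : IK⊢ (¬ₘ (◇ ⊥ₘ))
  a4 : ∀ φ ψ → IK⊢ (◇ (φ ∨ₘ ψ) ⇒ₘ (◇ φ ∨ₘ ◇ ψ))
  a5 : ∀ φ ψ → IK⊢ ((◇ φ ⇒ₘ □ ψ) ⇒ₘ □ (φ ⇒ₘ ψ))
  mp  : ∀ {φ ψ} → IK⊢ (φ ⇒ₘ ψ) → IK⊢ φ → IK⊢ ψ
  nec : ∀ {φ} → IK⊢ φ → IK⊢ (□ φ)

data IntCK⊢ : Fm → Set where
  ax-K   : ∀ φ ψ → IntCK⊢ (φ ⇒ (ψ ⇒ φ))
  ax-S   : ∀ φ ψ χ → IntCK⊢ ((φ ⇒ (ψ ⇒ χ)) ⇒ ((φ ⇒ ψ) ⇒ (φ ⇒ χ)))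
  ax-∧I  : ∀ φ ψ → IntCK⊢ (φ ⇒ (ψ ⇒ (φ ∧ ψ)))
  ax-∧E₁ : ∀ φ ψ → IntCK⊢ ((φ ∧ ψ) ⇒ φ)
  ax-∧E₂ : ∀ φ ψ → IntCK⊢ ((φ ∧ ψ) ⇒ ψ)
  ax-∨I₁ : ∀ φ ψ → IntCK⊢ (φ ⇒ (φ ∨ ψ))
  ax-∨I₂ : ∀ φ ψ → IntCK⊢ (ψ ⇒ (φ ∨ ψ))
  ax-∨E  : ∀ φ ψ χ → IntCK⊢ ((φ ⇒ χ) ⇒ ((ψ ⇒ χ) ⇒ ((φ ∨ ψ) ⇒ χ)))
  ax-⊥E  : ∀ φ → IntCK⊢ (⊥' ⇒ φ)
  ax-⊤   : IntCK⊢ ⊤'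
  A1 : ∀ φ ψ χ → IntCK⊢ (((φ □→ ψ) ∧ (φ □→ χ)) ⇔ (φ □→ (ψ ∧ χ)))
  A2 : ∀ φ ψ χ → IntCK⊢ (((φ ◇→ ψ) ∧ (φ □→ χ)) ⇒ (φ ◇→ (ψ ∧ χ)))
  A3 : ∀ φ ψ χ → IntCK⊢ ((φ ◇→ (ψ ∨ χ)) ⇔ ((φ ◇→ ψ) ∨ (φ ◇→ χ)))
  A4 : ∀ φ ψ χ → IntCK⊢ (((φ ◇→ ψ) ⇒ (φ □→ χ)) ⇒ (φ □→ (ψ ⇒ χ)))
  A5 : ∀ φ → IntCK⊢ (φ □→ ⊤')
  A6 : ∀ φ → IntCK⊢ (¬' (φ ◇→ ⊥'))
  mp    : ∀ {φ ψ} → IntCK⊢ (φ ⇒ ψ) → IntCK⊢ φ → IntCK⊢ ψ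
  RA□   : ∀ {φ ψ} χ → IntCK⊢ (φ ⇔ ψ) → IntCK⊢ ((φ □→ χ) ⇔ (ψ □→ χ))
  RC□   : ∀ {φ ψ} χ → IntCK⊢ (φ ⇔ ψ) → IntCK⊢ ((χ □→ φ) ⇔ (χ □→ ψ))
  RA◇   : ∀ {φ ψ} χ → IntCK⊢ (φ ⇔ ψ) → IntCK⊢ ((φ ◇→ χ) ⇔ (ψ ◇→ χ))
  RC◇   : ∀ {φ ψ} χ → IntCK⊢ (φ ⇔ ψ) → IntCK⊢ ((χ ◇→ φ) ⇔ (χ ◇→ ψ))

{-# OPTIONS --safe #-}
-- Soundness of Tr: every IK axiom translates into an IntCK theorem whose
-- conditionals all have antecedent ⊤, and necessitation becomes the rule
-- "from ψ infer ⊤ □→ ψ", derivable from A5 and RC□.  Faithfulness: erasing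
-- the antecedent of every conditional (φ □→ ψ ↦ □ ψ, φ ◇→ ψ ↦ ◇ ψ) is a left
-- inverse of Tr and maps IntCK theorems to IK theorems, since it turns the
-- antecedent rules RA□, RA◇ into instances of χ ↔ χ and the remaining
-- conditional axioms and rules into theorems and admissible rules of IK.
module Submission where

open import Defs
open import Data.Product using (_×_; _,_)
open import Relation.Binary.PropositionalEquality using (_≡_; refl; cong; cong₂; subst)

module HilbertIPC
  {F : Set} (_⊃_ _&_ : F → F → F) (⊢_ : F → Set)
  (K   : ∀ a b → ⊢ (a ⊃ (b ⊃ a)))
  (S   : ∀ a b c → ⊢ ((a ⊃ (b ⊃ c)) ⊃ ((a ⊃ b) ⊃ (a ⊃ c))))
  (&I  : ∀ a b → ⊢ (a ⊃ (b ⊃ (a & b))))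
  (&E₁ : ∀ a b → ⊢ ((a & b) ⊃ a))
  (&E₂ : ∀ a b → ⊢ ((a & b) ⊃ b))
  (MP  : ∀ {a b} → ⊢ (a ⊃ b) → ⊢ a → ⊢ b)
  where

  infix 3 _⟺_
  _⟺_ : F → F → F
  a ⟺ b = (a ⊃ b) & (b ⊃ a)

  ⇒-refl : ∀ a → ⊢ (a ⊃ a)
  ⇒-refl a = MP (MP (S a (a ⊃ a) a) (K a (a ⊃ a))) (K a a)

  ⇒-ap : ∀ {a b c} → ⊢ (a ⊃ (b ⊃ c)) → ⊢ (a ⊃ b) → ⊢ (a ⊃ c)
  ⇒-ap {a} {b} {c} p q = MP (MP (S a b c) p) q

  ⇒-const : ∀ {a} b → ⊢ a → ⊢ (b ⊃ a)
  ⇒-const {a} b p = MP (K a b) p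

  ⇒-trans : ∀ {a b c} → ⊢ (a ⊃ b) → ⊢ (b ⊃ c) → ⊢ (a ⊃ c)
  ⇒-trans {a} p q = ⇒-ap (⇒-const a q) p

  ⇒-pair : ∀ {a b c} → ⊢ (a ⊃ b) → ⊢ (a ⊃ c) → ⊢ (a ⊃ (b & c))
  ⇒-pair {b = b} {c} p q = ⇒-ap (⇒-trans p (&I b c)) q

  ⇒-curry : ∀ {a b c} → ⊢ ((a & b) ⊃ c) → ⊢ (a ⊃ (b ⊃ c))
  ⇒-curry {a} {b} p = ⇒-trans (&I a b) (MP (S b (a & b) _) (⇒-const b p))

  ⇒-uncurry : ∀ {a b c} → ⊢ (a ⊃ (b ⊃ c)) → ⊢ ((a & b) ⊃ c)
  ⇒-uncurry {a} {b} p = ⇒-ap (⇒-trans (&E₁ a b) p) (&E₂ a b)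

  ⇒-eval : ∀ a b → ⊢ (((a ⊃ b) & a) ⊃ b)
  ⇒-eval a b = ⇒-uncurry (⇒-refl (a ⊃ b))

  ∧-intro : ∀ {a b} → ⊢ a → ⊢ b → ⊢ (a & b)
  ∧-intro {a} {b} p q = MP (MP (&I a b) p) q

  ∧-proj₁ : ∀ {a b} → ⊢ (a & b) → ⊢ a
  ∧-proj₁ {a} {b} = MP (&E₁ a b)

  ∧-proj₂ : ∀ {a b} → ⊢ (a & b) → ⊢ b
  ∧-proj₂ {a} {b} = MP (&E₂ a b)

  ∧-swap : ∀ a b → ⊢ ((a & b) ⊃ (b & a))
  ∧-swap a b = ⇒-pair (&E₂ a b) (&E₁ a b)

  ⟺-refl : ∀ a → ⊢ (a ⟺ a)
  ⟺-refl a = ∧-intro (⇒-refl a) (⇒-refl a)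

  ⟺-cong : ∀ (f : F → F) → (∀ {a b} → ⊢ (a ⊃ b) → ⊢ (f a ⊃ f b)) →
           ∀ {a b} → ⊢ (a ⟺ b) → ⊢ (f a ⟺ f b)
  ⟺-cong f mono p = ∧-intro (mono (∧-proj₁ p)) (mono (∧-proj₂ p))

module IntCK where
  open HilbertIPC _⇒_ _∧_ IntCK⊢ ax-K ax-S ax-∧I ax-∧E₁ ax-∧E₂ mp public

  -- Only congruence rules are primitive: a → b yields a ↔ a ∧ b and a ∨ b ↔ b,
  -- and A1 resp. A3 split the conditional over the conjunction resp. disjunction.
  □→-monoʳ : ∀ c {a b} → IntCK⊢ (a ⇒ b) → IntCK⊢ ((c □→ a) ⇒ (c □→ b))
  □→-monoʳ c {a} {b} a⇒b =
    ⇒-trans (∧-proj₁ (RC□ c a⟺a∧b)) (⇒-trans (∧-proj₂ (A1 c a b)) (ax-∧E₂ _ _))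
    where
    a⟺a∧b : IntCK⊢ (a ⇔ (a ∧ b))
    a⟺a∧b = ∧-intro (⇒-pair (⇒-refl a) a⇒b) (ax-∧E₁ a b)

  ◇→-monoʳ : ∀ c {a b} → IntCK⊢ (a ⇒ b) → IntCK⊢ ((c ◇→ a) ⇒ (c ◇→ b))
  ◇→-monoʳ c {a} {b} a⇒b =
    ⇒-trans (ax-∨I₁ (c ◇→ a) (c ◇→ b))
      (⇒-trans (∧-proj₂ (A3 c a b)) (∧-proj₁ (RC◇ c a∨b⟺b)))
    where
    a∨b⟺b : IntCK⊢ ((a ∨ b) ⇔ b)
    a∨b⟺b = ∧-intro (mp (mp (ax-∨E a b b) a⇒b) (⇒-refl b)) (ax-∨I₂ a b)

  □→-nec : ∀ c {a} → IntCK⊢ a → IntCK⊢ (c □→ a)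
  □→-nec c {a} ⊢a = mp (∧-proj₁ (RC□ c ⊤⟺a)) (A5 c)
    where
    ⊤⟺a : IntCK⊢ (⊤' ⇔ a)
    ⊤⟺a = ∧-intro (⇒-const ⊤' ⊢a) (⇒-const a ax-⊤)

  □→-K : ∀ c a b → IntCK⊢ ((c □→ (a ⇒ b)) ⇒ ((c □→ a) ⇒ (c □→ b)))
  □→-K c a b = ⇒-curry (⇒-trans (∧-proj₁ (A1 c (a ⇒ b) a)) (□→-monoʳ c (⇒-eval a b)))

  ◇→-K : ∀ c a b → IntCK⊢ ((c □→ (a ⇒ b)) ⇒ ((c ◇→ a) ⇒ (c ◇→ b)))
  ◇→-K c a b = ⇒-curry (⇒-trans (∧-swap _ _) (⇒-trans (A2 c a (a ⇒ b))
    (◇→-monoʳ c (⇒-trans (∧-swap a (a ⇒ b)) (⇒-eval a b)))))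

module IK where
  open HilbertIPC _⇒ₘ_ _∧ₘ_ IK⊢ ax-K ax-S ax-∧I ax-∧E₁ ax-∧E₂ mp public

  □-mono : ∀ {a b} → IK⊢ (a ⇒ₘ b) → IK⊢ (□ a ⇒ₘ □ b)
  □-mono {a} {b} p = mp (a1 a b) (nec p)

  ◇-mono : ∀ {a b} → IK⊢ (a ⇒ₘ b) → IK⊢ (◇ a ⇒ₘ ◇ b)
  ◇-mono {a} {b} p = mp (a2 a b) (nec p)

  □-∧ : ∀ a b → IK⊢ ((□ a ∧ₘ □ b) ⟺ □ (a ∧ₘ b))
  □-∧ a b = ∧-intro
    (⇒-uncurry (⇒-trans (□-mono (ax-∧I a b)) (a1 b (a ∧ₘ b))))
    (⇒-pair (□-mono (ax-∧E₁ a b)) (□-mono (ax-∧E₂ a b)))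

  ◇-∧-□ : ∀ a b → IK⊢ ((◇ a ∧ₘ □ b) ⇒ₘ ◇ (a ∧ₘ b))
  ◇-∧-□ a b = ⇒-ap
    (⇒-trans (ax-∧E₂ _ _) (⇒-trans (□-mono (⇒-curry (∧-swap b a))) (a2 a (a ∧ₘ b))))
    (ax-∧E₁ _ _)

  ◇-∨ : ∀ a b → IK⊢ (◇ (a ∨ₘ b) ⟺ (◇ a ∨ₘ ◇ b))
  ◇-∨ a b = ∧-intro (a4 a b)
    (mp (mp (ax-∨E _ _ _) (◇-mono (ax-∨I₁ a b))) (◇-mono (ax-∨I₂ a b)))

module _ where
  open IntCK

  Tr-sound : ∀ {φ} → IK⊢ φ → IntCK⊢ (Tr φ)
  Tr-sound (ax-K _ _)    = ax-K _ _
  Tr-sound (ax-S _ _ _)  = ax-S _ _ _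
  Tr-sound (ax-∧I _ _)   = ax-∧I _ _
  Tr-sound (ax-∧E₁ _ _)  = ax-∧E₁ _ _
  Tr-sound (ax-∧E₂ _ _)  = ax-∧E₂ _ _
  Tr-sound (ax-∨I₁ _ _)  = ax-∨I₁ _ _
  Tr-sound (ax-∨I₂ _ _)  = ax-∨I₂ _ _
  Tr-sound (ax-∨E _ _ _) = ax-∨E _ _ _
  Tr-sound (ax-⊥E _)     = ax-⊥E _
  Tr-sound ax-⊤          = ax-⊤
  Tr-sound (a1 φ ψ)      = □→-K ⊤' (Tr φ) (Tr ψ)
  Tr-sound (a2 φ ψ)      = ◇→-K ⊤' (Tr φ) (Tr ψ)
  Tr-sound a3            = A6 ⊤'
  Tr-sound (a4 φ ψ)      = ∧-proj₁ (A3 ⊤' (Tr φ) (Tr ψ))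
  Tr-sound (a5 φ ψ)      = A4 ⊤' (Tr φ) (Tr ψ)
  Tr-sound (mp p q)      = mp (Tr-sound p) (Tr-sound q)
  Tr-sound (nec p)       = □→-nec ⊤' (Tr-sound p)

erase : Fm → Fmₘ
erase (var p)  = var p
erase ⊤'       = ⊤ₘ
erase ⊥'       = ⊥ₘ
erase (φ ∧ ψ)  = erase φ ∧ₘ erase ψ
erase (φ ∨ ψ)  = erase φ ∨ₘ erase ψ
erase (φ ⇒ ψ)  = erase φ ⇒ₘ erase ψ
erase (_ □→ ψ) = □ erase ψ
erase (_ ◇→ ψ) = ◇ erase ψ

erase-Tr : ∀ φ → erase (Tr φ) ≡ φ
erase-Tr (var p)  = refl
erase-Tr ⊤ₘ       = refl
erase-Tr ⊥ₘ       = refl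
erase-Tr (φ ∧ₘ ψ) = cong₂ _∧ₘ_ (erase-Tr φ) (erase-Tr ψ)
erase-Tr (φ ∨ₘ ψ) = cong₂ _∨ₘ_ (erase-Tr φ) (erase-Tr ψ)
erase-Tr (φ ⇒ₘ ψ) = cong₂ _⇒ₘ_ (erase-Tr φ) (erase-Tr ψ)
erase-Tr (□ φ)    = cong □_ (erase-Tr φ)
erase-Tr (◇ φ)    = cong ◇_ (erase-Tr φ)

module _ where
  open IK

  erase-sound : ∀ {φ} → IntCK⊢ φ → IK⊢ (erase φ)
  erase-sound (ax-K _ _)    = ax-K _ _
  erase-sound (ax-S _ _ _)  = ax-S _ _ _
  erase-sound (ax-∧I _ _)   = ax-∧I _ _
  erase-sound (ax-∧E₁ _ _)  = ax-∧E₁ _ _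
  erase-sound (ax-∧E₂ _ _)  = ax-∧E₂ _ _
  erase-sound (ax-∨I₁ _ _)  = ax-∨I₁ _ _
  erase-sound (ax-∨I₂ _ _)  = ax-∨I₂ _ _
  erase-sound (ax-∨E _ _ _) = ax-∨E _ _ _
  erase-sound (ax-⊥E _)     = ax-⊥E _
  erase-sound ax-⊤          = ax-⊤
  erase-sound (A1 _ ψ χ)    = □-∧ (erase ψ) (erase χ)
  erase-sound (A2 _ ψ χ)    = ◇-∧-□ (erase ψ) (erase χ)
  erase-sound (A3 _ ψ χ)    = ◇-∨ (erase ψ) (erase χ)
  erase-sound (A4 _ ψ χ)    = a5 (erase ψ) (erase χ)
  erase-sound (A5 _)        = nec ax-⊤
  erase-sound (A6 _)        = a3
  erase-sound (mp p q)      = mp (erase-sound p) (erase-sound q)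
  erase-sound (RA□ χ _)     = ⟺-refl (□ erase χ)
  erase-sound (RC□ _ p)     = ⟺-cong □_ □-mono (erase-sound p)
  erase-sound (RA◇ χ _)     = ⟺-refl (◇ erase χ)
  erase-sound (RC◇ _ p)     = ⟺-cong ◇_ ◇-mono (erase-sound p)

proposition4 : (φ : Fmₘ) → ((IK⊢ φ → IntCK⊢ (Tr φ)) × (IntCK⊢ (Tr φ) → IK⊢ φ))
proposition4 φ = Tr-sound , λ p → subst IK⊢ (erase-Tr φ) (erase-sound p)
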